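{- Define polynomials $p_n(x,y,z)$ by \[ \sum_{n=0}^\infty p_n(x,y,z)q^n=\prod_{j=0}^\infty\left(1+xq^{2^j}\right)\left(1+yq^{2^j}+zq^{2\cdot 2^j}\right), \] and for $n\ge 0$ set $Q_n(x,y,z)=p_{2^{n+1}-2}(x,y,z)$ and $R_n(x,y,z)=p_{2^n-1}(x,y,z)$, with the convention $Q_{ -1}:=0$. Let $s=(x^2y+xy^2+yz)^{1/2}$ (any fixed choice of square root, used consistently, with $s^n=(x^2y+xy^2+yz)^{n/2}$). Then for all $n\ge 0$, \begin{align*} Q_n(x,y,z)&=s^n\,U_n\!\left(\frac{xy+x+y+z}{2s}\right),\\ R_n(x,y,z)&=s^n\,T_n\!\left(\frac{xy+x+y+z}{2s}\right)+\frac{x+y-xy-z}{2}\,Q_{n-1}(x,y,z). \end{align*}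
   Context: $T_n$ and $U_n$ are the Chebyshev polynomials of the first and second kind, defined by $\sum_{n\ge0}T_n(w)v^n=\frac{1-wv}{1-2wv+v^2}$ and $\sum_{n\ge0}U_n(w)v^n=\frac{1}{1-2wv+v^2}$. -}

module Defs where

open import Algebra.Bundles using (CommutativeRing)
open import Data.Nat as ℕ using (ℕ; zero; suc; _∸_)
open import Relation.Nullary using (yes; no)

module _ {c ℓ} (R : CommutativeRing c ℓ) where
  open CommutativeRing R

  pow : Carrier → ℕ → Carrier
  pow a zero    = 1#
  pow a (suc n) = a * pow a n

  two : Carrier
  two = 1# + 1#

  Series : Set c
  Series = ℕ → Carrier

  sumTo : ℕ → (ℕ → Carrier) → Carrier
  sumTo zero    h = h 0
  sumTo (suc n) h = sumTo n h + h (suc n)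

  conv : Series → Series → Series
  conv f g n = sumTo n (λ k → f k * g (n ∸ k))

  addS : Series → Series → Series
  addS f g n = f n + g n

  mono : Carrier → ℕ → Series
  mono a d n with n ℕ.≟ d
  ... | yes _ = a
  ... | no  _ = 0#

  oneS : Series
  oneS = mono 1# 0

  factor : Carrier → Carrier → Carrier → ℕ → Series
  factor x y z j =
    conv (addS oneS (mono x (2 ℕ.^ j)))
         (addS oneS (addS (mono y (2 ℕ.^ j)) (mono z (2 ℕ.* 2 ℕ.^ j))))

  prodTo : Carrier → Carrier → Carrier → ℕ → Series
  prodTo x y z zero    = oneS
  prodTo x y z (suc J) = conv (prodTo x y z J) (factor x y z J)

  -- p_n(x,y,z) = coefficient of q^n in the infinite product; factors with
  -- j ≥ n+1 have 2^j > n and do not affect this coefficient.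
  p : Carrier → Carrier → Carrier → ℕ → Carrier
  p x y z n = prodTo x y z (suc n) n

  Q : Carrier → Carrier → Carrier → ℕ → Carrier
  Q x y z n = p x y z (2 ℕ.^ suc n ∸ 2)

  Rp : Carrier → Carrier → Carrier → ℕ → Carrier
  Rp x y z n = p x y z (2 ℕ.^ n ∸ 1)

  Qprev : Carrier → Carrier → Carrier → ℕ → Carrier
  Qprev x y z zero    = 0#
  Qprev x y z (suc n) = Q x y z n

  -- Chebyshev polynomials evaluated at w; the recurrences are exactly the
  -- coefficient recurrences of the generating functions
  -- (1-wv)/(1-2wv+v^2) and 1/(1-2wv+v^2).
  T : ℕ → Carrier → Carrier
  T zero          w = 1#
  T (suc zero)    w = w
  T (suc (suc n)) w = two * w * T (suc n) w - T n w

  U : ℕ → Carrier → Carrier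
  U zero          w = 1#
  U (suc zero)    w = two * w
  U (suc (suc n)) w = two * w * U (suc n) w - U n w

-- With f(q) = (1 + xq)(1 + yq + zq²) = 1 + (x+y)q + (xy+z)q² + xzq³, the product
-- F(q) = ∏ⱼ f(q^{2^j}) satisfies F(q) = f(q) F(q²).  Comparing the coefficients of q^{2m}
-- and q^{2m+1} gives p_{2m} = p_m + (xy+z) p_{m-1} and p_{2m+1} = (x+y) p_m + xz p_{m-1},
-- which at m = 2^n - 1 read Q_n = R_n + (xy+z) Q_{n-1} and R_{n+1} = (x+y) R_n + xz Q_{n-1}.
-- Eliminating R gives Q_{n+1} = (xy+x+y+z) Q_n - s² Q_{n-1}, the recurrence of s^n U_n(w)
-- for 2sw = xy+x+y+z, and T_n = U_n - w U_{n-1} turns R_n = Q_n - (xy+z) Q_{n-1} into the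
-- second formula.  Over an arbitrary commutative ring the functional equation is proved for
-- the truncated products, which stabilise: the j-th factor only touches degrees ≥ 2^j.

module Submission where

open import Defs
open import Algebra.Bundles using (CommutativeRing)
open import Data.Nat using (ℕ)
open import Data.Product using (_×_; _,_; proj₁; proj₂)

open import Data.Empty using (⊥-elim)
open import Data.Integer as ℤ using (ℤ; +_; -[1+_]; _⊖_; _◃_; sign; ∣_∣)
import Data.Integer.Properties as ℤ
open import Data.Maybe using (Maybe; just; nothing)
open import Data.Nat as ℕ using (zero; suc; _∸_; _≤_; _<_; _≤′_; z≤n; s≤s)
import Data.Nat.Properties as ℕ
open import Data.Sign as Sign using (Sign)
open import Data.Sum using (inj₁; inj₂)
open import Level using (_⊔_)
open import Relation.Nullary using (yes; no)
open import Relation.Binary.PropositionalEquality as ≡ using (_≡_; _≢_)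
open import Algebra.Solver.Ring.AlmostCommutativeRing
  using (fromCommutativeRing; _-Raw-AlmostCommutative⟶_)
import Algebra.Solver.Ring as RingSolver
import Algebra.Properties.Ring as RingProperties
import Algebra.Properties.CommutativeSemigroup as CommutativeSemigroupProperties
import Algebra.Properties.Semiring.Mult.TCOptimised as SemiringMultiplication

double : ℕ → ℕ
double zero    = 0
double (suc n) = suc (suc (double n))

double≡2* : ∀ n → double n ≡ 2 ℕ.* n
double≡2* zero    = ≡.refl
double≡2* (suc n) = ≡.cong suc (≡.trans (≡.cong suc (double≡2* n)) (≡.sym (ℕ.+-suc n (n ℕ.+ 0))))

n≤double : ∀ n → n ≤ double n
n≤double zero    = z≤n
n≤double (suc n) = s≤s (ℕ.m≤n⇒m≤1+n (n≤double n))

ones : ℕ → ℕ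
ones zero    = 0
ones (suc n) = suc (double (ones n))

2^n≡1+ones : ∀ n → 2 ℕ.^ n ≡ suc (ones n)
2^n≡1+ones zero    = ≡.refl
2^n≡1+ones (suc n) = ≡.trans (≡.cong (2 ℕ.*_) (2^n≡1+ones n)) (≡.sym (double≡2* (suc (ones n))))

n<2^n : ∀ n → n < 2 ℕ.^ n
n<2^n zero    = s≤s z≤n
n<2^n (suc n) = ℕ.≤-<-trans (n<2^n n) (ℕ.^-monoʳ-< 2 (s≤s (s≤s z≤n)) (ℕ.n<1+n n))

-- Algebra.Solver.Ring decides identities by computing normal forms over a coefficient
-- ring; ℤ, which maps into every commutative ring, makes those normal forms compute.
module IntegerCoefficientSolver {c ℓ} (R : CommutativeRing c ℓ) where
  open CommutativeRing R
  open RingProperties ring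
  open SemiringMultiplication semiring using (1+×; ×-homo-+; ×1-homo-*) renaming (_×_ to _×ᵣ_)
  open CommutativeSemigroupProperties +-commutativeSemigroup
    using () renaming (interchange to +-interchange)
  open CommutativeSemigroupProperties *-commutativeSemigroup
    using () renaming (interchange to *-interchange)
  open import Relation.Binary.Reasoning.Setoid setoid

  fromℤ : ℤ → Carrier
  fromℤ (+ n)      = n ×ᵣ 1#
  fromℤ -[1+ n ]   = - (suc n ×ᵣ 1#)

  fromSign : Sign → Carrier
  fromSign Sign.+ = 1#
  fromSign Sign.- = - 1#

  ⊖-homo : ∀ m n → fromℤ (m ⊖ n) ≈ m ×ᵣ 1# - n ×ᵣ 1#
  ⊖-homo m zero = begin
    fromℤ (m ⊖ 0)  ≡⟨ ≡.cong fromℤ (ℤ.⊖-≥ {m} z≤n) ⟩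
    m ×ᵣ 1#         ≈⟨ +-identityʳ _ ⟨
    m ×ᵣ 1# + 0#    ≈⟨ +-congˡ -0#≈0# ⟨
    m ×ᵣ 1# - 0#    ∎
  ⊖-homo zero (suc n) = sym (+-identityˡ _)
  ⊖-homo (suc m) (suc n) = begin
    fromℤ (suc m ⊖ suc n)              ≡⟨ ≡.cong fromℤ (ℤ.[1+m]⊖[1+n]≡m⊖n m n) ⟩
    fromℤ (m ⊖ n)                      ≈⟨ ⊖-homo m n ⟩
    m ×ᵣ 1# - n ×ᵣ 1#                    ≈⟨ +-identityˡ _ ⟨
    0# + (m ×ᵣ 1# - n ×ᵣ 1#)             ≈⟨ +-congʳ (-‿inverseʳ 1#) ⟨
    (1# - 1#) + (m ×ᵣ 1# - n ×ᵣ 1#)      ≈⟨ +-interchange 1# (- 1#) (m ×ᵣ 1#) (- (n ×ᵣ 1#)) ⟩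
    (1# + m ×ᵣ 1#) + (- 1# - n ×ᵣ 1#)    ≈⟨ +-congˡ (-‿+-comm 1# (n ×ᵣ 1#)) ⟩
    (1# + m ×ᵣ 1#) - (1# + n ×ᵣ 1#)      ≈⟨ +-cong (1+× m 1#) (-‿cong (1+× n 1#)) ⟨
    suc m ×ᵣ 1# - suc n ×ᵣ 1#            ∎

  +-homo : ∀ i j → fromℤ (i ℤ.+ j) ≈ fromℤ i + fromℤ j
  +-homo (+ m)    (+ n)    = ×-homo-+ 1# m n
  +-homo (+ m)    -[1+ n ] = ⊖-homo m (suc n)
  +-homo -[1+ m ] (+ n)    = trans (⊖-homo n (suc m)) (+-comm _ _)
  +-homo -[1+ m ] -[1+ n ] = begin
    - (suc (suc m ℕ.+ n) ×ᵣ 1#)      ≡⟨ ≡.cong (λ k → - (suc k ×ᵣ 1#)) (ℕ.+-suc m n) ⟨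
    - ((suc m ℕ.+ suc n) ×ᵣ 1#)      ≈⟨ -‿cong (×-homo-+ 1# (suc m) (suc n)) ⟩
    - (suc m ×ᵣ 1# + suc n ×ᵣ 1#)     ≈⟨ -‿+-comm _ _ ⟨
    - (suc m ×ᵣ 1#) - suc n ×ᵣ 1#     ∎

  ◃-homo : ∀ s n → fromℤ (s ◃ n) ≈ fromSign s * n ×ᵣ 1#
  ◃-homo s      zero    = sym (zeroʳ _)
  ◃-homo Sign.+ (suc n) = sym (*-identityˡ _)
  ◃-homo Sign.- (suc n) = sym (-1*x≈-x _)

  sign-*-homo : ∀ s t → fromSign (s Sign.* t) ≈ fromSign s * fromSign t
  sign-*-homo Sign.+ t      = sym (*-identityˡ _)
  sign-*-homo Sign.- Sign.+ = sym (*-identityʳ _)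
  sign-*-homo Sign.- Sign.- = trans (sym (-‿involutive 1#)) (sym (-1*x≈-x (- 1#)))

  *-homo : ∀ i j → fromℤ (i ℤ.* j) ≈ fromℤ i * fromℤ j
  *-homo i j = begin
    fromℤ (sign i Sign.* sign j ◃ ∣ i ∣ ℕ.* ∣ j ∣)
      ≈⟨ ◃-homo (sign i Sign.* sign j) (∣ i ∣ ℕ.* ∣ j ∣) ⟩
    fromSign (sign i Sign.* sign j) * (∣ i ∣ ℕ.* ∣ j ∣) ×ᵣ 1#
      ≈⟨ *-cong (sign-*-homo (sign i) (sign j)) (×1-homo-* ∣ i ∣ ∣ j ∣) ⟩
    (fromSign (sign i) * fromSign (sign j)) * (∣ i ∣ ×ᵣ 1# * ∣ j ∣ ×ᵣ 1#)
      ≈⟨ *-interchange _ _ _ _ ⟩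
    (fromSign (sign i) * ∣ i ∣ ×ᵣ 1#) * (fromSign (sign j) * ∣ j ∣ ×ᵣ 1#)
      ≈⟨ *-cong (signAbs-homo i) (signAbs-homo j) ⟨
    fromℤ i * fromℤ j ∎
    where
    signAbs-homo : ∀ k → fromℤ k ≈ fromSign (sign k) * ∣ k ∣ ×ᵣ 1#
    signAbs-homo (+ n)    = sym (*-identityˡ _)
    signAbs-homo -[1+ n ] = sym (-1*x≈-x _)

  -‿homo : ∀ i → fromℤ (ℤ.- i) ≈ - fromℤ i
  -‿homo (+ zero)  = sym -0#≈0#
  -‿homo (+ suc n) = refl
  -‿homo -[1+ n ]  = sym (-‿involutive _)

  fromℤ-homomorphism : ℤ.+-*-rawRing -Raw-AlmostCommutative⟶ fromCommutativeRing R
  fromℤ-homomorphism = record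
    { ⟦_⟧    = fromℤ
    ; +-homo = +-homo
    ; *-homo = *-homo
    ; -‿homo = -‿homo
    ; 0-homo = refl
    ; 1-homo = refl
    }

  fromℤ-≟ : ∀ i j → Maybe (fromℤ i ≈ fromℤ j)
  fromℤ-≟ i j with i ℤ.≟ j
  ... | yes ≡.refl = just refl
  ... | no _       = nothing

  open RingSolver ℤ.+-*-rawRing (fromCommutativeRing R) fromℤ-homomorphism fromℤ-≟ public

module PowerSeries {c ℓ} (R : CommutativeRing c ℓ) where
  open CommutativeRing R
  open RingProperties ring using (+-cancelʳ)
  open IntegerCoefficientSolver R using (solve; _:=_; _:+_; _:*_; con)
  open CommutativeSemigroupProperties +-commutativeSemigroup
    using () renaming (interchange to +-interchange)
  open CommutativeSemigroupProperties *-commutativeSemigroup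
    using () renaming (x∙yz≈y∙xz to *-leftSwap)
  open import Relation.Binary.Reasoning.Setoid setoid

  infix 4 _≐_
  _≐_ : Series R → Series R → Set ℓ
  f ≐ g = ∀ n → f n ≈ g n

  infixr 7 _·_
  _·_ : Carrier → Series R → Series R
  (k · g) n = k * g n

  record IsLinear (L : Series R → Series R) : Set (c ⊔ ℓ) where
    field
      cong   : ∀ {g h} → g ≐ h → L g ≐ L h
      +-homo : ∀ g h → L (addS R g h) ≐ addS R (L g) (L h)
      ·-homo : ∀ k g → L (k · g) ≐ k · L g

  sumTo-cong : ∀ n {f g : Series R} → (∀ {k} → k ≤ n → f k ≈ g k) → sumTo R n f ≈ sumTo R n g
  sumTo-cong zero    f≈g = f≈g z≤n
  sumTo-cong (suc n) f≈g = +-cong (sumTo-cong n (λ k≤n → f≈g (ℕ.m≤n⇒m≤1+n k≤n))) (f≈g ℕ.≤-refl)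

  sumTo-+ : ∀ n (f g : Series R) → sumTo R n (addS R f g) ≈ sumTo R n f + sumTo R n g
  sumTo-+ zero    f g = refl
  sumTo-+ (suc n) f g = trans (+-congʳ (sumTo-+ n f g)) (+-interchange _ _ _ _)

  sumTo-· : ∀ n k (f : Series R) → sumTo R n (k · f) ≈ k * sumTo R n f
  sumTo-· zero    k f = refl
  sumTo-· (suc n) k f = trans (+-congʳ (sumTo-· n k f)) (sym (distribˡ k _ _))

  sumTo-vanishing : ∀ n {f : Series R} → (∀ {k} → k ≤ n → f k ≈ 0#) → sumTo R n f ≈ 0#
  sumTo-vanishing zero    f≈0 = f≈0 z≤n
  sumTo-vanishing (suc n) f≈0 =
    trans (+-cong (sumTo-vanishing n (λ k≤n → f≈0 (ℕ.m≤n⇒m≤1+n k≤n))) (f≈0 ℕ.≤-refl)) (+-identityʳ 0#)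

  sumTo-single : ∀ {n k₀} (f : Series R) → k₀ ≤ n →
                 (∀ {k} → k ≤ n → k ≢ k₀ → f k ≈ 0#) → sumTo R n f ≈ f k₀
  sumTo-single {zero} f z≤n _ = refl
  sumTo-single {suc n} {k₀} f k₀≤1+n others with k₀ ℕ.≟ suc n
  ... | yes ≡.refl =
    trans (+-congʳ (sumTo-vanishing n (λ k≤n → others (ℕ.m≤n⇒m≤1+n k≤n) (ℕ.<⇒≢ (s≤s k≤n)))))
          (+-identityˡ _)
  ... | no k₀≢1+n = trans (+-cong (sumTo-single f (ℕ.s≤s⁻¹ (ℕ.≤∧≢⇒< k₀≤1+n k₀≢1+n))
                                                  (λ k≤n → others (ℕ.m≤n⇒m≤1+n k≤n)))
                                  (others ℕ.≤-refl (≡.≢-sym k₀≢1+n)))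
                          (+-identityʳ _)

  mono-≡ : ∀ a d → mono R a d d ≡ a
  mono-≡ a d with d ℕ.≟ d
  ... | yes _   = ≡.refl
  ... | no  d≢d = ⊥-elim (d≢d ≡.refl)

  mono-≢ : ∀ a {d m} → m ≢ d → mono R a d m ≡ 0#
  mono-≢ a {d} {m} m≢d with m ℕ.≟ d
  ... | yes m≡d = ⊥-elim (m≢d m≡d)
  ... | no  _   = ≡.refl

  mono-suc : ∀ a d m → mono R a (suc d) (suc m) ≡ mono R a d m
  mono-suc a d m with m ℕ.≟ d
  ... | yes ≡.refl = mono-≡ a (suc d)
  ... | no  m≢d    = mono-≢ a (λ 1+m≡1+d → m≢d (ℕ.suc-injective 1+m≡1+d))

  -- shift d g = q^d g; in particular shift 1 f is n ↦ f_{n-1} with f_{-1} = 0.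
  shift : ℕ → Series R → Series R
  shift zero    g n       = g n
  shift (suc d) g zero    = 0#
  shift (suc d) g (suc n) = shift d g n

  shift-linear : ∀ d → IsLinear (shift d)
  shift-linear d = record { cong = cong d ; +-homo = +-homo d ; ·-homo = ·-homo d }
    where
    cong : ∀ d {g h} → g ≐ h → shift d g ≐ shift d h
    cong zero    g≐h n       = g≐h n
    cong (suc d) g≐h zero    = refl
    cong (suc d) g≐h (suc n) = cong d g≐h n
    +-homo : ∀ d g h → shift d (addS R g h) ≐ addS R (shift d g) (shift d h)
    +-homo zero    g h n       = refl
    +-homo (suc d) g h zero    = sym (+-identityʳ 0#)
    +-homo (suc d) g h (suc n) = +-homo d g h n
    ·-homo : ∀ d k g → shift d (k · g) ≐ k · shift d g
    ·-homo zero    k g n       = refl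
    ·-homo (suc d) k g zero    = sym (zeroʳ k)
    ·-homo (suc d) k g (suc n) = ·-homo d k g n

  shift-shift : ∀ d e (g : Series R) n → shift d (shift e g) n ≡ shift (d ℕ.+ e) g n
  shift-shift zero    e g n       = ≡.refl
  shift-shift (suc d) e g zero    = ≡.refl
  shift-shift (suc d) e g (suc n) = shift-shift d e g n

  shift-comm : ∀ d e (g : Series R) n → shift d (shift e g) n ≡ shift e (shift d g) n
  shift-comm d e g n = ≡.trans (shift-shift d e g n)
    (≡.trans (≡.cong (λ k → shift k g n) (ℕ.+-comm d e)) (≡.sym (shift-shift e d g n)))

  shift-≥ : ∀ {d n} (g : Series R) → d ≤ n → shift d g n ≡ g (n ∸ d)
  shift-≥ {zero}          g _         = ≡.refl
  shift-≥ {suc d} {suc n} g (s≤s d≤n) = shift-≥ g d≤n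

  shift-< : ∀ {d n} (g : Series R) → n < d → shift d g n ≡ 0#
  shift-< {suc d} {zero}  g _         = ≡.refl
  shift-< {suc d} {suc n} g (s≤s n<d) = shift-< g n<d

  shift-mono : ∀ e a d → shift e (mono R a d) ≐ mono R a (e ℕ.+ d)
  shift-mono zero    a d n       = refl
  shift-mono (suc e) a d zero    = refl
  shift-mono (suc e) a d (suc n) = trans (shift-mono e a d n) (reflexive (≡.sym (mono-suc a (e ℕ.+ d) n)))

  conv-linear : ∀ g → IsLinear (conv R g)
  conv-linear g = record
    { cong   = λ h≐h′ n → sumTo-cong n (λ {k} _ → *-congˡ (h≐h′ (n ∸ k)))
    ; +-homo = λ h h′ n → trans (sumTo-cong n (λ _ → distribˡ _ _ _)) (sumTo-+ n _ _)
    ; ·-homo = λ k h n → trans (sumTo-cong n (λ _ → *-leftSwap _ k _)) (sumTo-· n k _)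
    }

  conv-+ˡ : ∀ g g′ h → conv R (addS R g g′) h ≐ addS R (conv R g h) (conv R g′ h)
  conv-+ˡ g g′ h n = trans (sumTo-cong n (λ _ → distribʳ _ _ _)) (sumTo-+ n _ _)

  conv-monoʳ : ∀ g a d → conv R g (mono R a d) ≐ a · shift d g
  conv-monoʳ g a d n with d ℕ.≤? n
  ... | yes d≤n = begin
    conv R g (mono R a d) n               ≈⟨ sumTo-single _ (ℕ.m∸n≤m n d) off-diagonal ⟩
    g (n ∸ d) * mono R a d (n ∸ (n ∸ d))  ≡⟨ ≡.cong (λ k → g (n ∸ d) * mono R a d k) (ℕ.m∸[m∸n]≡n d≤n) ⟩
    g (n ∸ d) * mono R a d d              ≡⟨ ≡.cong (g (n ∸ d) *_) (mono-≡ a d) ⟩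
    g (n ∸ d) * a                         ≈⟨ *-comm _ a ⟩
    a * g (n ∸ d)                         ≡⟨ ≡.cong (a *_) (shift-≥ g d≤n) ⟨
    a * shift d g n                       ∎
    where
    off-diagonal : ∀ {k} → k ≤ n → k ≢ n ∸ d → g k * mono R a d (n ∸ k) ≈ 0#
    off-diagonal {k} k≤n k≢n∸d = trans (*-congˡ (reflexive (mono-≢ a n∸k≢d))) (zeroʳ _)
      where
      n∸k≢d : n ∸ k ≢ d
      n∸k≢d n∸k≡d = k≢n∸d (≡.trans (≡.sym (ℕ.m∸[m∸n]≡n k≤n)) (≡.cong (n ∸_) n∸k≡d))
  ... | no d≰n = begin
    conv R g (mono R a d) n
      ≈⟨ sumTo-vanishing n (λ {k} _ → trans (*-congˡ (reflexive (mono-≢ a (n∸k≢d k)))) (zeroʳ _)) ⟩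
    0#                       ≈⟨ zeroʳ a ⟨
    a * 0#                   ≡⟨ ≡.cong (a *_) (shift-< g (ℕ.≰⇒> d≰n)) ⟨
    a * shift d g n          ∎
    where
    n∸k≢d : ∀ k → n ∸ k ≢ d
    n∸k≢d k n∸k≡d = d≰n (≡.subst (_≤ n) n∸k≡d (ℕ.m∸n≤m n k))

  conv-monoˡ : ∀ a d g → conv R (mono R a d) g ≐ a · shift d g
  conv-monoˡ a d g n with d ℕ.≤? n
  ... | yes d≤n = begin
    conv R (mono R a d) g n
      ≈⟨ sumTo-single _ d≤n (λ k≤n k≢d → trans (*-congʳ (reflexive (mono-≢ a k≢d))) (zeroˡ _)) ⟩
    mono R a d d * g (n ∸ d)   ≡⟨ ≡.cong₂ _*_ (mono-≡ a d) (≡.sym (shift-≥ g d≤n)) ⟩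
    a * shift d g n            ∎
  ... | no d≰n = begin
    conv R (mono R a d) g n
      ≈⟨ sumTo-vanishing n (λ k≤n → trans (*-congʳ (reflexive (mono-≢ a (k≢d k≤n)))) (zeroˡ _)) ⟩
    0#                       ≈⟨ zeroʳ a ⟨
    a * 0#                   ≡⟨ ≡.cong (a *_) (shift-< g (ℕ.≰⇒> d≰n)) ⟨
    a * shift d g n          ∎
    where
    k≢d : ∀ {k} → k ≤ n → k ≢ d
    k≢d k≤n ≡.refl = d≰n k≤n

  -- The exponent e + 0 makes shift d (trinomial u v w 0 d) literally trinomial u v w d d.
  trinomial : Carrier → Carrier → Carrier → ℕ → ℕ → Series R
  trinomial u v w e d =
    addS R (mono R u (e ℕ.+ 0)) (addS R (mono R v (e ℕ.+ d)) (mono R w (e ℕ.+ 2 ℕ.* d)))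

  conv-trinomial : ∀ g u v w e d n →
    conv R g (trinomial u v w e d) n
      ≈ u * shift (e ℕ.+ 0) g n + (v * shift (e ℕ.+ d) g n + w * shift (e ℕ.+ 2 ℕ.* d) g n)
  conv-trinomial g u v w e d n =
    trans (+-homo (mono R u (e ℕ.+ 0)) (addS R (mono R v (e ℕ.+ d)) (mono R w (e ℕ.+ 2 ℕ.* d))) n)
      (+-cong (conv-monoʳ g u _ n)
        (trans (+-homo (mono R v (e ℕ.+ d)) (mono R w (e ℕ.+ 2 ℕ.* d)) n)
          (+-cong (conv-monoʳ g v _ n) (conv-monoʳ g w _ n))))
    where open IsLinear (conv-linear g)

  shift-trinomial : ∀ u v w d → shift d (trinomial u v w 0 d) ≐ trinomial u v w d d
  shift-trinomial u v w d n =
    trans (+-homo (mono R u 0) (addS R (mono R v d) (mono R w (2 ℕ.* d))) n)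
      (+-cong (shift-mono d u 0 n)
        (trans (+-homo (mono R v d) (mono R w (2 ℕ.* d)) n)
          (+-cong (shift-mono d v d n) (shift-mono d w (2 ℕ.* d) n))))
    where open IsLinear (shift-linear d)

  -- dilate g = g(q²)
  dilate : Series R → Series R
  dilate g zero          = g 0
  dilate g (suc zero)    = 0#
  dilate g (suc (suc n)) = dilate (λ m → g (suc m)) n

  dilate-double : ∀ (g : Series R) m → dilate g (double m) ≡ g m
  dilate-double g zero    = ≡.refl
  dilate-double g (suc m) = dilate-double (λ k → g (suc k)) m

  dilate-suc-double : ∀ (g : Series R) m → dilate g (suc (double m)) ≡ 0#
  dilate-suc-double g zero    = ≡.refl
  dilate-suc-double g (suc m) = dilate-suc-double (λ k → g (suc k)) m

  dilate-linear : IsLinear dilate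
  dilate-linear = record { cong = cong ; +-homo = +-homo ; ·-homo = ·-homo }
    where
    cong : ∀ {g h} → g ≐ h → dilate g ≐ dilate h
    cong g≐h zero          = g≐h 0
    cong g≐h (suc zero)    = refl
    cong g≐h (suc (suc n)) = cong (λ m → g≐h (suc m)) n
    +-homo : ∀ g h → dilate (addS R g h) ≐ addS R (dilate g) (dilate h)
    +-homo g h zero          = refl
    +-homo g h (suc zero)    = sym (+-identityʳ 0#)
    +-homo g h (suc (suc n)) = +-homo (λ m → g (suc m)) (λ m → h (suc m)) n
    ·-homo : ∀ k g → dilate (k · g) ≐ k · dilate g
    ·-homo k g zero          = refl
    ·-homo k g (suc zero)    = sym (zeroʳ k)
    ·-homo k g (suc (suc n)) = ·-homo k (λ m → g (suc m)) n

  dilate-oneS : dilate (oneS R) ≐ oneS R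
  dilate-oneS zero          = refl
  dilate-oneS (suc zero)    = refl
  dilate-oneS (suc (suc n)) = dilate-0 n
    where
    dilate-0 : dilate (λ _ → 0#) ≐ (λ _ → 0#)
    dilate-0 zero          = refl
    dilate-0 (suc zero)    = refl
    dilate-0 (suc (suc n)) = dilate-0 n

  dilate-shift : ∀ d (g : Series R) → dilate (shift d g) ≐ shift (double d) (dilate g)
  dilate-shift zero    g n             = refl
  dilate-shift (suc d) g zero          = refl
  dilate-shift (suc d) g (suc zero)    = refl
  dilate-shift (suc d) g (suc (suc n)) = dilate-shift d g n

  shift-double-dilate-double : ∀ e (g : Series R) m → shift (double e) (dilate g) (double m) ≈ shift e g m
  shift-double-dilate-double e g m =
    trans (sym (dilate-shift e g (double m))) (reflexive (dilate-double (shift e g) m))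

  shift-odd-dilate-double : ∀ e (g : Series R) m → shift (suc (double e)) (dilate g) (double m) ≡ 0#
  shift-odd-dilate-double e       g zero    = ≡.refl
  shift-odd-dilate-double zero    g (suc m) = dilate-suc-double g m
  shift-odd-dilate-double (suc e) g (suc m) = shift-odd-dilate-double e g m

  recurrence-unique : ∀ {α β} {f g : Series R} →
                      (∀ n → f (suc n) + β * shift 1 f n ≈ α * f n) →
                      (∀ n → g (suc n) + β * shift 1 g n ≈ α * g n) →
                      f 0 ≈ g 0 → f ≐ g
  recurrence-unique {α} {β} {f} {g} f-rec g-rec f₀≈g₀ n = proj₁ (agree n)
    where
    agree : ∀ n → f n ≈ g n × shift 1 f n ≈ shift 1 g n
    agree zero    = f₀≈g₀ , refl
    agree (suc n) = +-cancelʳ (β * shift 1 f n) _ _ (begin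
      f (suc n) + β * shift 1 f n  ≈⟨ f-rec n ⟩
      α * f n                      ≈⟨ *-congˡ fₙ≈gₙ ⟩
      α * g n                      ≈⟨ g-rec n ⟨
      g (suc n) + β * shift 1 g n  ≈⟨ +-congˡ (*-congˡ f₋≈g₋) ⟨
      g (suc n) + β * shift 1 f n  ∎) , fₙ≈gₙ
      where
      fₙ≈gₙ = proj₁ (agree n)
      f₋≈g₋ = proj₂ (agree n)

  shift-cong-< : ∀ {N} {g h : Series R} → (∀ {k} → k < N → g k ≈ h k) →
                 ∀ d {n} → n < d ℕ.+ N → shift d g n ≈ shift d h n
  shift-cong-< g≈h zero            n<N          = g≈h n<N
  shift-cong-< g≈h (suc d) {zero}  _            = refl
  shift-cong-< g≈h (suc d) {suc n} (s≤s n<d+N) = shift-cong-< g≈h d n<d+N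

  module Cubic (c₁ c₂ c₃ : Carrier) where

    combine : (h₀ h₁ h₂ h₃ : Series R) → Series R
    combine h₀ h₁ h₂ h₃ = addS R h₀ (addS R (c₁ · h₁) (addS R (c₂ · h₂) (c₃ · h₃)))

    -- mulCubic d g = f(q^d) g  for  f(q) = 1 + c₁ q + c₂ q² + c₃ q³.
    mulCubic : ℕ → Series R → Series R
    mulCubic d g = combine g (shift d g) (shift (2 ℕ.* d) g) (shift (3 ℕ.* d) g)

    combine-cong : ∀ {h₀ h₁ h₂ h₃ h₀′ h₁′ h₂′ h₃′} →
                   h₀ ≐ h₀′ → h₁ ≐ h₁′ → h₂ ≐ h₂′ → h₃ ≐ h₃′ →
                   combine h₀ h₁ h₂ h₃ ≐ combine h₀′ h₁′ h₂′ h₃′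
    combine-cong e₀ e₁ e₂ e₃ n =
      +-cong (e₀ n) (+-cong (*-congˡ (e₁ n)) (+-cong (*-congˡ (e₂ n)) (*-congˡ (e₃ n))))

    combine-congʳ : ∀ h₀ {h₁ h₂ h₃ h₁′ h₂′ h₃′} → h₁ ≐ h₁′ → h₂ ≐ h₂′ → h₃ ≐ h₃′ →
                    combine h₀ h₁ h₂ h₃ ≐ combine h₀ h₁′ h₂′ h₃′
    combine-congʳ h₀ = combine-cong {h₀ = h₀} (λ _ → refl)

    combine-linear : ∀ {L} → IsLinear L → ∀ h₀ h₁ h₂ h₃ →
                     L (combine h₀ h₁ h₂ h₃) ≐ combine (L h₀) (L h₁) (L h₂) (L h₃)
    combine-linear {L} L-linear h₀ h₁ h₂ h₃ n = begin
      L (combine h₀ h₁ h₂ h₃) n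
        ≈⟨ +-homo _ _ n ⟩
      L h₀ n + L (addS R (c₁ · h₁) (addS R (c₂ · h₂) (c₃ · h₃))) n
        ≈⟨ +-congˡ (+-homo _ _ n) ⟩
      L h₀ n + (L (c₁ · h₁) n + L (addS R (c₂ · h₂) (c₃ · h₃)) n)
        ≈⟨ +-congˡ (+-cong (·-homo c₁ h₁ n) (+-homo _ _ n)) ⟩
      L h₀ n + (c₁ * L h₁ n + (L (c₂ · h₂) n + L (c₃ · h₃) n))
        ≈⟨ +-congˡ (+-congˡ (+-cong (·-homo c₂ h₂ n) (·-homo c₃ h₃ n))) ⟩
      combine (L h₀) (L h₁) (L h₂) (L h₃) n ∎
      where open IsLinear L-linear

    combine-+ : ∀ g₀ g₁ g₂ g₃ h₀ h₁ h₂ h₃ →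
                combine (addS R g₀ h₀) (addS R g₁ h₁) (addS R g₂ h₂) (addS R g₃ h₃)
                  ≐ addS R (combine g₀ g₁ g₂ g₃) (combine h₀ h₁ h₂ h₃)
    combine-+ g₀ g₁ g₂ g₃ h₀ h₁ h₂ h₃ n =
      solve 11 (λ c₁ c₂ c₃ g₀ g₁ g₂ g₃ h₀ h₁ h₂ h₃ →
        (g₀ :+ h₀) :+ (c₁ :* (g₁ :+ h₁) :+ (c₂ :* (g₂ :+ h₂) :+ c₃ :* (g₃ :+ h₃)))
          := (g₀ :+ (c₁ :* g₁ :+ (c₂ :* g₂ :+ c₃ :* g₃))) :+ (h₀ :+ (c₁ :* h₁ :+ (c₂ :* h₂ :+ c₃ :* h₃))))
        refl c₁ c₂ c₃ (g₀ n) (g₁ n) (g₂ n) (g₃ n) (h₀ n) (h₁ n) (h₂ n) (h₃ n)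

    combine-· : ∀ k h₀ h₁ h₂ h₃ →
                combine (k · h₀) (k · h₁) (k · h₂) (k · h₃) ≐ k · combine h₀ h₁ h₂ h₃
    combine-· k h₀ h₁ h₂ h₃ n =
      solve 8 (λ c₁ c₂ c₃ k h₀ h₁ h₂ h₃ →
        k :* h₀ :+ (c₁ :* (k :* h₁) :+ (c₂ :* (k :* h₂) :+ c₃ :* (k :* h₃)))
          := k :* (h₀ :+ (c₁ :* h₁ :+ (c₂ :* h₂ :+ c₃ :* h₃))))
        refl c₁ c₂ c₃ k (h₀ n) (h₁ n) (h₂ n) (h₃ n)

    mulCubic-linear : ∀ d → IsLinear (mulCubic d)
    mulCubic-linear d = record
      { cong   = λ g≐h → combine-cong g≐h (S.cong d g≐h) (S.cong (2 ℕ.* d) g≐h) (S.cong (3 ℕ.* d) g≐h)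
      ; +-homo = λ g h n → trans
          (combine-congʳ (addS R g h)
             (S.+-homo d g h) (S.+-homo (2 ℕ.* d) g h) (S.+-homo (3 ℕ.* d) g h) n)
          (combine-+ g (shift d g) (shift (2 ℕ.* d) g) (shift (3 ℕ.* d) g)
                     h (shift d h) (shift (2 ℕ.* d) h) (shift (3 ℕ.* d) h) n)
      ; ·-homo = λ k g n → trans
          (combine-congʳ (k · g)
             (S.·-homo d k g) (S.·-homo (2 ℕ.* d) k g) (S.·-homo (3 ℕ.* d) k g) n)
          (combine-· k g (shift d g) (shift (2 ℕ.* d) g) (shift (3 ℕ.* d) g) n)
      }
      where module S d = IsLinear (shift-linear d)

    shift-mulCubic : ∀ e d g → shift e (mulCubic d g) ≐ mulCubic d (shift e g)
    shift-mulCubic e d g n =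
      trans (combine-linear (shift-linear e) g (shift d g) (shift (2 ℕ.* d) g) (shift (3 ℕ.* d) g) n)
      (combine-congʳ (shift e g) (commute d) (commute (2 ℕ.* d)) (commute (3 ℕ.* d)) n)
      where
      commute : ∀ k → shift e (shift k g) ≐ shift k (shift e g)
      commute k m = reflexive (shift-comm e k g m)

    mulCubic-comm : ∀ d e g → mulCubic d (mulCubic e g) ≐ mulCubic e (mulCubic d g)
    mulCubic-comm d e g n = trans
      (combine-congʳ (mulCubic e g)
         (shift-mulCubic d e g) (shift-mulCubic (2 ℕ.* d) e g) (shift-mulCubic (3 ℕ.* d) e g) n)
      (sym (combine-linear (mulCubic-linear e) g (shift d g) (shift (2 ℕ.* d) g) (shift (3 ℕ.* d) g) n))

    dilate-mulCubic : ∀ d g → dilate (mulCubic d g) ≐ mulCubic (2 ℕ.* d) (dilate g)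
    dilate-mulCubic d g n =
      trans (combine-linear dilate-linear g (shift d g) (shift (2 ℕ.* d) g) (shift (3 ℕ.* d) g) n)
      (combine-congʳ (dilate g) (dilate-shift′ (double≡2* d))
                    (dilate-shift′ (double≡2* (2 ℕ.* d)))
                    (dilate-shift′ (≡.trans (double≡2* (3 ℕ.* d)) 2*3*d≡3*2*d)) n)
      where
      dilate-shift′ : ∀ {k k′} → double k ≡ k′ → dilate (shift k g) ≐ shift k′ (dilate g)
      dilate-shift′ {k} ≡.refl = dilate-shift k g
      2*3*d≡3*2*d : 2 ℕ.* (3 ℕ.* d) ≡ 3 ℕ.* (2 ℕ.* d)
      2*3*d≡3*2*d = ≡.trans (≡.sym (ℕ.*-assoc 2 3 d)) (ℕ.*-assoc 3 2 d)

    mulCubic-< : ∀ {d n} g → n < d → mulCubic d g n ≈ g n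
    mulCubic-< {d} {n} g n<d = begin
      mulCubic d g n
        ≡⟨ ≡.cong₂ (λ u v → g n + (c₁ * u + v)) (shift-< g n<d)
             (≡.cong₂ (λ u v → c₂ * u + c₃ * v) (shift-< g (below 1)) (shift-< g (below 2))) ⟩
      g n + (c₁ * 0# + (c₂ * 0# + c₃ * 0#))
        ≈⟨ solve 4 (λ c₁ c₂ c₃ u → u :+ (c₁ :* con (+ 0) :+ (c₂ :* con (+ 0) :+ c₃ :* con (+ 0))) := u)
                   refl c₁ c₂ c₃ (g n) ⟩
      g n ∎
      where
      below : ∀ k → n < suc k ℕ.* d
      below k = ℕ.<-≤-trans n<d (ℕ.m≤m+n d (k ℕ.* d))

    mulCubic-dilate-double : ∀ g m → mulCubic 1 (dilate g) (double m) ≈ g m + c₂ * shift 1 g m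
    mulCubic-dilate-double g m = begin
      mulCubic 1 (dilate g) (double m)
        ≈⟨ +-cong (reflexive (dilate-double g m))
             (+-cong (*-congˡ (reflexive (shift-odd-dilate-double 0 g m)))
               (+-cong (*-congˡ (shift-double-dilate-double 1 g m))
                 (*-congˡ (reflexive (shift-odd-dilate-double 1 g m))))) ⟩
      g m + (c₁ * 0# + (c₂ * shift 1 g m + c₃ * 0#))
        ≈⟨ solve 5 (λ c₁ c₂ c₃ u v → u :+ (c₁ :* con (+ 0) :+ (c₂ :* v :+ c₃ :* con (+ 0))) := u :+ c₂ :* v)
                   refl c₁ c₂ c₃ (g m) (shift 1 g m) ⟩
      g m + c₂ * shift 1 g m ∎

    mulCubic-dilate-suc-double : ∀ g m →
      mulCubic 1 (dilate g) (suc (double m)) ≈ c₁ * g m + c₃ * shift 1 g m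
    mulCubic-dilate-suc-double g m = begin
      mulCubic 1 (dilate g) (suc (double m))
        ≈⟨ +-cong (reflexive (dilate-suc-double g m))
             (+-cong (*-congˡ (reflexive (dilate-double g m)))
               (+-cong (*-congˡ (reflexive (shift-odd-dilate-double 0 g m)))
                 (*-congˡ (shift-double-dilate-double 1 g m)))) ⟩
      0# + (c₁ * g m + (c₂ * 0# + c₃ * shift 1 g m))
        ≈⟨ solve 5 (λ c₁ c₂ c₃ u v →
                     con (+ 0) :+ (c₁ :* u :+ (c₂ :* con (+ 0) :+ c₃ :* v)) := c₁ :* u :+ c₃ :* v)
                   refl c₁ c₂ c₃ (g m) (shift 1 g m) ⟩
      c₁ * g m + c₃ * shift 1 g m ∎

module InfiniteProduct {c ℓ} (R : CommutativeRing c ℓ) (x y z : CommutativeRing.Carrier R) where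
  open CommutativeRing R hiding (zero)
  open PowerSeries R
  open Cubic (x + y) (x * y + z) (x * z)
  open IntegerCoefficientSolver R using (solve; _:=_; _:+_; _:*_; _:-_; con)
  open import Relation.Binary.Reasoning.Setoid setoid

  factor-expand : ∀ j → let B = trinomial 1# y z 0 (2 ℕ.^ j) in
                  factor R x y z j ≐ addS R B (x · shift (2 ℕ.^ j) B)
  factor-expand j n = trans (conv-+ˡ (oneS R) (mono R x d) B n)
    (+-cong (trans (conv-monoˡ 1# 0 B n) (*-identityˡ _)) (conv-monoˡ x d B n))
    where
    d = 2 ℕ.^ j
    B = trinomial 1# y z 0 d

  conv-factor : ∀ g j → conv R g (factor R x y z j) ≐ mulCubic (2 ℕ.^ j) g
  conv-factor g j n = begin
    conv R g (factor R x y z j) n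
      ≈⟨ cong (factor-expand j) n ⟩
    conv R g (addS R B (x · shift d B)) n
      ≈⟨ trans (+-homo B (x · shift d B) n) (+-congˡ (·-homo x (shift d B) n)) ⟩
    conv R g B n + x * conv R g (shift d B) n
      ≈⟨ +-congˡ (*-congˡ (cong (shift-trinomial 1# y z d) n)) ⟩
    conv R g B n + x * conv R g (trinomial 1# y z d d) n
      ≈⟨ +-cong (conv-trinomial g 1# y z 0 d n) (*-congˡ (conv-trinomial g 1# y z d d n)) ⟩
    (1# * g n + (y * shift d g n + z * shift (2 ℕ.* d) g n))
      + x * (1# * shift (d ℕ.+ 0) g n + (y * shift (d ℕ.+ d) g n + z * shift (3 ℕ.* d) g n))
      ≡⟨ ≡.cong₂ (λ e e′ → conv-B + x * (1# * shift e g n + (y * shift e′ g n + z * shift (3 ℕ.* d) g n)))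
                 (ℕ.+-identityʳ d) (≡.cong (d ℕ.+_) (≡.sym (ℕ.+-identityʳ d))) ⟩
    (1# * g n + (y * shift d g n + z * shift (2 ℕ.* d) g n))
      + x * (1# * shift d g n + (y * shift (2 ℕ.* d) g n + z * shift (3 ℕ.* d) g n))
      ≈⟨ solve 7 (λ x y z g₀ g₁ g₂ g₃ →
           (con (+ 1) :* g₀ :+ (y :* g₁ :+ z :* g₂)) :+ x :* (con (+ 1) :* g₁ :+ (y :* g₂ :+ z :* g₃))
             := g₀ :+ ((x :+ y) :* g₁ :+ ((x :* y :+ z) :* g₂ :+ x :* z :* g₃)))
           refl x y z (g n) (shift d g n) (shift (2 ℕ.* d) g n) (shift (3 ℕ.* d) g n) ⟩
    mulCubic d g n ∎
    where
    open IsLinear (conv-linear g)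
    d = 2 ℕ.^ j
    B = trinomial 1# y z 0 d
    conv-B = 1# * g n + (y * shift d g n + z * shift (2 ℕ.* d) g n)

  P : ℕ → Series R
  P = prodTo R x y z

  -- The factor f(q) moves to the front, and dilation turns f(q^{2^j}) into f(q^{2^{j+1}}).
  prodTo-suc-dilate : ∀ J → P (suc J) ≐ mulCubic 1 (dilate (P J))
  prodTo-suc-dilate zero n = trans (conv-factor (oneS R) 0 n) (M₁.cong (λ m → sym (dilate-oneS m)) n)
    where module M₁ = IsLinear (mulCubic-linear 1)
  prodTo-suc-dilate (suc J) n = begin
    P (suc (suc J)) n                            ≈⟨ conv-factor (P (suc J)) (suc J) n ⟩
    mulCubic d′ (P (suc J)) n                    ≈⟨ M′.cong (prodTo-suc-dilate J) n ⟩
    mulCubic d′ (mulCubic 1 (dilate (P J))) n    ≈⟨ mulCubic-comm d′ 1 (dilate (P J)) n ⟩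
    mulCubic 1 (mulCubic d′ (dilate (P J))) n    ≈⟨ M₁.cong (λ m → sym (dilate-mulCubic d (P J) m)) n ⟩
    mulCubic 1 (dilate (mulCubic d (P J))) n     ≈⟨ M₁.cong (D.cong (λ m → sym (conv-factor (P J) J m))) n ⟩
    mulCubic 1 (dilate (P (suc J))) n            ∎
    where
    d  = 2 ℕ.^ J
    d′ = 2 ℕ.^ suc J
    module D  = IsLinear dilate-linear
    module M₁ = IsLinear (mulCubic-linear 1)
    module M′ = IsLinear (mulCubic-linear d′)

  prodTo-stable : ∀ {J K n} → n < 2 ℕ.^ J → J ≤′ K → P K n ≈ P J n
  prodTo-stable n<2^J (ℕ.≤′-reflexive ≡.refl) = refl
  prodTo-stable {J} {suc K} {n} n<2^J (ℕ.≤′-step J≤′K) =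
    trans (trans (conv-factor (P K) K n) (mulCubic-< (P K) n<2^K)) (prodTo-stable n<2^J J≤′K)
    where
    n<2^K : n < 2 ℕ.^ K
    n<2^K = ℕ.<-≤-trans n<2^J (ℕ.^-monoʳ-≤ 2 (ℕ.≤′⇒≤ J≤′K))

  prodTo≈p : ∀ J {n} → n < 2 ℕ.^ J → P J n ≈ p R x y z n
  prodTo≈p J {n} n<2^J with ℕ.≤-total J (suc n)
  ... | inj₁ J≤1+n = sym (prodTo-stable n<2^J (ℕ.≤⇒≤′ J≤1+n))
  ... | inj₂ 1+n≤J = prodTo-stable (ℕ.<-≤-trans (n<2^n n) (ℕ.^-monoʳ-≤ 2 (ℕ.n≤1+n n))) (ℕ.≤⇒≤′ 1+n≤J)

  F : Series R
  F = p R x y z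

  shift1-prodTo≈F : ∀ J {m} → m < 2 ℕ.^ J → shift 1 (P J) m ≈ shift 1 F m
  shift1-prodTo≈F J m<2^J = shift-cong-< (prodTo≈p J) 1 (ℕ.m<n⇒m<1+n m<2^J)

  F-double : ∀ m → F (double m) ≈ F m + (x * y + z) * shift 1 F m
  F-double m = begin
    P (suc J) (double m)                           ≈⟨ prodTo-suc-dilate J (double m) ⟩
    mulCubic 1 (dilate (P J)) (double m)           ≈⟨ mulCubic-dilate-double (P J) m ⟩
    P J m + (x * y + z) * shift 1 (P J) m
      ≈⟨ +-cong (prodTo≈p J m<2^J) (*-congˡ (shift1-prodTo≈F J m<2^J)) ⟩
    F m + (x * y + z) * shift 1 F m                ∎
    where
    J = double m
    m<2^J : m < 2 ℕ.^ J
    m<2^J = ℕ.<-≤-trans (n<2^n m) (ℕ.^-monoʳ-≤ 2 (n≤double m))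

  F-suc-double : ∀ m → F (suc (double m)) ≈ (x + y) * F m + x * z * shift 1 F m
  F-suc-double m = begin
    P (suc J) (suc (double m))                       ≈⟨ prodTo-suc-dilate J (suc (double m)) ⟩
    mulCubic 1 (dilate (P J)) (suc (double m))       ≈⟨ mulCubic-dilate-suc-double (P J) m ⟩
    (x + y) * P J m + x * z * shift 1 (P J) m
      ≈⟨ +-cong (*-congˡ (prodTo≈p J m<2^J)) (*-congˡ (shift1-prodTo≈F J m<2^J)) ⟩
    (x + y) * F m + x * z * shift 1 F m              ∎
    where
    J = suc (double m)
    m<2^J : m < 2 ℕ.^ J
    m<2^J = ℕ.<-≤-trans (n<2^n m) (ℕ.^-monoʳ-≤ 2 (ℕ.m≤n⇒m≤1+n (n≤double m)))

  q : Series R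
  q = Q R x y z

  Q≡F : ∀ n → Q R x y z n ≡ F (double (ones n))
  Q≡F n = ≡.cong (λ k → F (k ∸ 2)) (2^n≡1+ones (suc n))

  Rp≡F : ∀ n → Rp R x y z n ≡ F (ones n)
  Rp≡F n = ≡.cong (λ k → F (k ∸ 1)) (2^n≡1+ones n)

  shift1-Q≡shift1-F : ∀ n → shift 1 q n ≡ shift 1 F (ones n)
  shift1-Q≡shift1-F zero    = ≡.refl
  shift1-Q≡shift1-F (suc n) = Q≡F n

  Qprev≡shift1-Q : ∀ n → Qprev R x y z n ≡ shift 1 q n
  Qprev≡shift1-Q zero    = ≡.refl
  Qprev≡shift1-Q (suc n) = ≡.refl

  Q₀≈1 : q 0 ≈ 1#
  Q₀≈1 = sym (prodTo≈p 0 (s≤s z≤n))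

  Q-rec : ∀ n → q n ≈ Rp R x y z n + (x * y + z) * shift 1 q n
  Q-rec n = begin
    q n                                          ≡⟨ Q≡F n ⟩
    F (double (ones n))                          ≈⟨ F-double (ones n) ⟩
    F (ones n) + (x * y + z) * shift 1 F (ones n)
      ≡⟨ ≡.cong₂ (λ u v → u + (x * y + z) * v) (Rp≡F n) (shift1-Q≡shift1-F n) ⟨
    Rp R x y z n + (x * y + z) * shift 1 q n     ∎

  R-rec : ∀ n → Rp R x y z (suc n) ≈ (x + y) * Rp R x y z n + x * z * shift 1 q n
  R-rec n = begin
    Rp R x y z (suc n)                           ≡⟨ Rp≡F (suc n) ⟩
    F (suc (double (ones n)))                    ≈⟨ F-suc-double (ones n) ⟩
    (x + y) * F (ones n) + x * z * shift 1 F (ones n)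
      ≡⟨ ≡.cong₂ (λ u v → (x + y) * u + x * z * v) (Rp≡F n) (shift1-Q≡shift1-F n) ⟨
    (x + y) * Rp R x y z n + x * z * shift 1 q n ∎

  Q-three-term : ∀ n → q (suc n) + ((x + y) * (x * y + z) - x * z) * shift 1 q n
                         ≈ ((x + y) + (x * y + z)) * q n
  Q-three-term n = begin
    q (suc n) + (b * a - c′) * shift 1 q n
      ≈⟨ +-congʳ (trans (Q-rec (suc n)) (+-congʳ (R-rec n))) ⟩
    ((b * r + c′ * q₋) + a * q n) + (b * a - c′) * q₋
      ≈⟨ solve 6 (λ a b c′ r q₋ qₙ → ((b :* r :+ c′ :* q₋) :+ a :* qₙ) :+ (b :* a :- c′) :* q₋
                                      := b :* (r :+ a :* q₋) :+ a :* qₙ)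
                 refl a b c′ r q₋ (q n) ⟩
    b * (r + a * q₋) + a * q n      ≈⟨ +-congʳ (*-congˡ (Q-rec n)) ⟨
    b * q n + a * q n               ≈⟨ distribʳ (q n) b a ⟨
    (b + a) * q n                   ∎
    where
    a  = x * y + z
    b  = x + y
    c′ = x * z
    r  = Rp R x y z n
    q₋ = shift 1 q n

module Chebyshev {c ℓ} (R : CommutativeRing c ℓ) where
  open CommutativeRing R hiding (zero)
  open RingProperties ring using (+-cancelʳ)
  open PowerSeries R
  open IntegerCoefficientSolver R using (solve; _:=_; _:+_; _:*_; _:-_; con)
  open import Relation.Binary.Reasoning.Setoid setoid

  U-rec : ∀ w n → U R (suc n) w + shift 1 (λ k → U R k w) n ≈ two R * w * U R n w
  U-rec w zero    = solve 1 (λ w → con (+ 2) :* w :+ con (+ 0) := con (+ 2) :* w :* con (+ 1)) refl w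
  U-rec w (suc n) = solve 3 (λ v u₁ u₀ → (v :* u₁ :- u₀) :+ u₀ := v :* u₁) refl (two R * w) (U R (suc n) w) (U R n w)

  T+wU₋≈U : ∀ w n → T R n w + w * shift 1 (λ k → U R k w) n ≈ U R n w
  T+wU₋≈U w zero          = solve 1 (λ w → con (+ 1) :+ w :* con (+ 0) := con (+ 1)) refl w
  T+wU₋≈U w (suc zero)    = solve 1 (λ w → w :+ w :* con (+ 1) := con (+ 2) :* w) refl w
  T+wU₋≈U w (suc (suc n)) = begin
    (two R * w * T₁ - T₀) + w * U₁
      ≈⟨ +-congʳ (+-cong (*-congˡ (x+y≈z⇒x≈z-y (T+wU₋≈U w (suc n))))
                         (-‿cong (x+y≈z⇒x≈z-y (T+wU₋≈U w n)))) ⟩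
    (two R * w * (U₁ - w * U₀) - (U₀ - w * U₋)) + w * U₁
      ≈⟨ solve 4 (λ w u₁ u₀ u₋ →
           (con (+ 2) :* w :* (u₁ :- w :* u₀) :- (u₀ :- w :* u₋)) :+ w :* u₁
             := (con (+ 2) :* w :* u₁ :- u₀) :+ w :* ((u₁ :+ u₋) :- con (+ 2) :* w :* u₀))
           refl w U₁ U₀ U₋ ⟩
    (two R * w * U₁ - U₀) + w * ((U₁ + U₋) - two R * w * U₀)
      ≈⟨ +-congˡ (*-congˡ (+-congʳ (U-rec w n))) ⟩
    (two R * w * U₁ - U₀) + w * (two R * w * U₀ - two R * w * U₀)
      ≈⟨ solve 4 (λ w u₁ u₀ v → (con (+ 2) :* w :* u₁ :- u₀) :+ w :* (v :- v) := con (+ 2) :* w :* u₁ :- u₀)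
           refl w U₁ U₀ (two R * w * U₀) ⟩
    two R * w * U₁ - U₀ ∎
    where
    T₁ = T R (suc n) w
    T₀ = T R n w
    U₁ = U R (suc n) w
    U₀ = U R n w
    U₋ = shift 1 (λ k → U R k w) n
    x+y≈z⇒x≈z-y : ∀ {a b d} → a + b ≈ d → a ≈ d - b
    x+y≈z⇒x≈z-y {a} {b} a+b≈d = trans (solve 2 (λ a b → a := (a :+ b) :- b) refl a b) (+-congʳ a+b≈d)

  scaledU : Carrier → Carrier → Series R
  scaledU s w n = pow R s n * U R n w

  shift1-scaled : ∀ s (f : Series R) n → s * shift 1 (λ k → pow R s k * f k) n ≈ pow R s n * shift 1 f n
  shift1-scaled s f zero    = trans (zeroʳ s) (sym (*-identityˡ 0#))
  shift1-scaled s f (suc n) = sym (*-assoc s (pow R s n) (f n))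

  scaledU-rec : ∀ s w n → scaledU s w (suc n) + (s * s) * shift 1 (scaledU s w) n
                            ≈ (s * (two R * w)) * scaledU s w n
  scaledU-rec s w n = begin
    (s * sⁿ) * U₁ + (s * s) * shift 1 (scaledU s w) n
      ≈⟨ +-congˡ (trans (*-assoc s s _) (*-congˡ (shift1-scaled s u n))) ⟩
    (s * sⁿ) * U₁ + s * (sⁿ * shift 1 u n)
      ≈⟨ solve 4 (λ s sⁿ u₁ u₋ → (s :* sⁿ) :* u₁ :+ s :* (sⁿ :* u₋) := (s :* sⁿ) :* (u₁ :+ u₋))
           refl s sⁿ U₁ (shift 1 u n) ⟩
    (s * sⁿ) * (U₁ + shift 1 u n)
      ≈⟨ *-congˡ (U-rec w n) ⟩
    (s * sⁿ) * (two R * w * u n)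
      ≈⟨ solve 4 (λ s sⁿ w u₀ → (s :* sⁿ) :* (con (+ 2) :* w :* u₀) := (s :* (con (+ 2) :* w)) :* (sⁿ :* u₀))
           refl s sⁿ w (u n) ⟩
    (s * (two R * w)) * scaledU s w n ∎
    where
    u  = λ k → U R k w
    sⁿ = pow R s n
    U₁ = U R (suc n) w

  scaledT+swU₋≈scaledU : ∀ s w n → pow R s n * T R n w + (s * w) * shift 1 (scaledU s w) n ≈ scaledU s w n
  scaledT+swU₋≈scaledU s w n = begin
    sⁿ * T R n w + (s * w) * shift 1 (scaledU s w) n
      ≈⟨ +-congˡ (trans (*-congʳ (*-comm s w)) (trans (*-assoc w s _) (*-congˡ (shift1-scaled s u n)))) ⟩
    sⁿ * T R n w + w * (sⁿ * shift 1 u n)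
      ≈⟨ solve 4 (λ sⁿ t w u₋ → sⁿ :* t :+ w :* (sⁿ :* u₋) := sⁿ :* (t :+ w :* u₋))
                 refl sⁿ (T R n w) w (shift 1 u n) ⟩
    sⁿ * (T R n w + w * shift 1 u n)
      ≈⟨ *-congˡ (T+wU₋≈U w n) ⟩
    scaledU s w n ∎
    where
    u  = λ k → U R k w
    sⁿ = pow R s n

  scaledT-from-scaledU : ∀ {s w e k} {q r : Series R} → q ≐ scaledU s w →
                         (∀ n → r n + k * shift 1 q n ≈ q n) → e + k ≈ s * w →
                         ∀ n → r n ≈ pow R s n * T R n w + e * shift 1 q n
  scaledT-from-scaledU {s} {w} {e} {k} {q} {r} q≐V r+kq₋≈q e+k≈sw n = +-cancelʳ (k * q₋) _ _ (begin
    r n + k * q₋                              ≈⟨ r+kq₋≈q n ⟩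
    q n                                       ≈⟨ q≐V n ⟩
    scaledU s w n                             ≈⟨ scaledT+swU₋≈scaledU s w n ⟨
    sⁿTₙ + (s * w) * shift 1 (scaledU s w) n
      ≈⟨ +-congˡ (*-cong e+k≈sw (IsLinear.cong (shift-linear 1) q≐V n)) ⟨
    sⁿTₙ + (e + k) * q₋
      ≈⟨ solve 4 (λ a e k q₋ → a :+ (e :+ k) :* q₋ := (a :+ e :* q₋) :+ k :* q₋) refl sⁿTₙ e k q₋ ⟩
    (sⁿTₙ + e * q₋) + k * q₋                  ∎)
    where
    q₋   = shift 1 q n
    sⁿTₙ = pow R s n * T R n w

module _ {c ℓ} (R : CommutativeRing c ℓ) where
  open CommutativeRing R
  open IntegerCoefficientSolver R using (solve; _:=_; _:+_; _:*_; _:-_; con)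
  open import Relation.Binary.Reasoning.Setoid setoid

  module ChebyshevArgument (x y z s h t : Carrier) (h*2≈1 : h * (1# + 1#) ≈ 1#) (s*t≈1 : s * t ≈ 1#)
    (s*s≈x²y+xy²+yz : s * s ≈ x * x * y + x * y * y + y * z) where

    W w : Carrier
    W = x * y + x + y + z
    w = W * h * t

    s*w≈W*h : s * w ≈ W * h
    s*w≈W*h = begin
      s * (W * h * t)  ≈⟨ solve 4 (λ s W h t → s :* (W :* h :* t) := W :* h :* (s :* t)) refl s W h t ⟩
      W * h * (s * t)  ≈⟨ *-congˡ s*t≈1 ⟩
      W * h * 1#       ≈⟨ *-identityʳ _ ⟩
      W * h            ∎

    s*2w≈[x+y]+[xy+z] : s * (two R * w) ≈ (x + y) + (x * y + z)
    s*2w≈[x+y]+[xy+z] = begin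
      s * (two R * w)  ≈⟨ solve 2 (λ s w → s :* (con (+ 2) :* w) := con (+ 2) :* (s :* w)) refl s w ⟩
      two R * (s * w)  ≈⟨ *-congˡ s*w≈W*h ⟩
      two R * (W * h)  ≈⟨ solve 2 (λ W h → con (+ 2) :* (W :* h) := W :* (h :* con (+ 2))) refl W h ⟩
      W * (h * two R)  ≈⟨ trans (*-congˡ h*2≈1) (*-identityʳ W) ⟩
      W                ≈⟨ solve 3 (λ x y z → x :* y :+ x :+ y :+ z := (x :+ y) :+ (x :* y :+ z)) refl x y z ⟩
      (x + y) + (x * y + z) ∎

    s*s≈[x+y][xy+z]-xz : s * s ≈ (x + y) * (x * y + z) - x * z
    s*s≈[x+y][xy+z]-xz = trans s*s≈x²y+xy²+yz
      (solve 3 (λ x y z → x :* x :* y :+ x :* y :* y :+ y :* z := (x :+ y) :* (x :* y :+ z) :- x :* z)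
             refl x y z)

    [x+y-xy-z]h+xy+z≈sw : (x + y - x * y - z) * h + (x * y + z) ≈ s * w
    [x+y-xy-z]h+xy+z≈sw = begin
      (x + y - x * y - z) * h + (x * y + z)
        ≈⟨ +-congˡ (trans (*-congˡ h*2≈1) (*-identityʳ _)) ⟨
      (x + y - x * y - z) * h + (x * y + z) * (h * two R)
        ≈⟨ solve 4 (λ x y z h → (x :+ y :- x :* y :- z) :* h :+ (x :* y :+ z) :* (h :* con (+ 2))
                                  := (x :* y :+ x :+ y :+ z) :* h)
                   refl x y z h ⟩
      W * h
        ≈⟨ s*w≈W*h ⟨
      s * w ∎

proposition3p3 : ∀ {c ℓ} (R : CommutativeRing c ℓ) →
    let open CommutativeRing R in
    (x y z s h t : Carrier) →
    h * (1# + 1#) ≈ 1# →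
    s * t ≈ 1# →
    s * s ≈ x * x * y + x * y * y + y * z →
    (n : ℕ) →
    (Q R x y z n ≈ pow R s n * U R n ((x * y + x + y + z) * h * t))
    × (Rp R x y z n ≈ pow R s n * T R n ((x * y + x + y + z) * h * t)
                      + (x + y - x * y - z) * h * Qprev R x y z n)
proposition3p3 R x y z s h t h*2≈1 s*t≈1 s*s≈x²y+xy²+yz n = Q≐scaledU n , R-formula
  where
  open CommutativeRing R
  open PowerSeries R using (_≐_; recurrence-unique)
  open InfiniteProduct R x y z using (q; Q₀≈1; Q-rec; Q-three-term; Qprev≡shift1-Q)
  open Chebyshev R using (scaledU; scaledU-rec; scaledT-from-scaledU)
  open ChebyshevArgument R x y z s h t h*2≈1 s*t≈1 s*s≈x²y+xy²+yz

  Q≐scaledU : q ≐ scaledU s w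
  Q≐scaledU = recurrence-unique
    (λ k → trans (+-congˡ (*-congʳ s*s≈[x+y][xy+z]-xz))
                 (trans (Q-three-term k) (*-congʳ (sym s*2w≈[x+y]+[xy+z]))))
    (scaledU-rec s w)
    (trans Q₀≈1 (sym (*-identityʳ 1#)))

  R-formula : Rp R x y z n ≈ pow R s n * T R n w + (x + y - x * y - z) * h * Qprev R x y z n
  R-formula = trans (scaledT-from-scaledU Q≐scaledU (λ k → sym (Q-rec k)) [x+y-xy-z]h+xy+z≈sw n)
                    (+-congˡ (*-congˡ (reflexive (≡.sym (Qprev≡shift1-Q n)))))
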